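{- Let U-Box-Doubling (described in the context) be run on a connected shape $S_I$ of order $n$. Then in every phase $i$, the set of occupied $2^i\times 2^i$ sub-boxes (those containing at least one node) forms a connected "super-shape", i.e., it is connected when two sub-boxes are considered adjacent iff they share a side or a corner.
   Context: Nodes occupy distinct cells of the two-dimensional square grid. A shape is a finite set of nodes; two nodes $(x_1,y_1),(x_2,y_2)$ are neighbours iff $|x_1-x_2|\le 1$ and $|y_1-y_2|\le 1$; a shape is connected iff its neighbour graph is connected. A line is a set of one or more nodes in consecutive cells of one row or column; a line move shifts all nodes of a line by one cell along its own direction into the empty cell adjacent to one of its endpoints, in one step. U-Box-Doubling (assume $n$ is a power of 2): enclose the shape in an $n\times n$ box; for phases $i=1,\dots,\log n$, partition the box into disjoint $2^i\times 2^i$ sub-boxes (each being the union of four $2^{i-1}\times2^{i-1}$ sub-boxes of the previous phase). Inductively, at the start of phase $i$ every $2^{i-1}\times2^{i-1}$ sub-box is empty or has its nodes forming completely filled bottommost rows plus possibly one incomplete left-aligned row (or, symmetrically, filled leftmost columns plus one bottom-aligned incomplete column, alternating with the parity of $i$). In phase $i$ (odd case), within each $2^i\times2^i$ sub-box every row-line is moved left to the sub-box's left boundary, and then the columns of the sub-box are filled from the leftmost column rightwards, pushing the nodes of a possible incomplete column to its bottom; even phases are symmetric. In phase $i$ nodes are moved only within their own $2^i\times2^i$ sub-box. Phase $0$ refers to the initial shape with $1\times1$ sub-boxes. -}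

module Defs where

open import Data.Bool using (Bool; true; false; if_then_else_; T)
open import Data.Nat using (ℕ; zero; suc; _+_; _*_; _^_; _≤_; ∣_-_∣; _<ᵇ_)
open import Data.Nat.DivMod using (_/_; _%_)
open import Data.Nat.Properties using (m^n≢0)
open import Data.Product using (_×_)

-- A configuration of the grid: occupancy predicate on cells (x , y) ∈ ℕ × ℕ.
-- The enclosing n × n box is placed at [0,n) × [0,n).
Grid : Set
Grid = ℕ → ℕ → Bool

sumBelow : ℕ → (ℕ → ℕ) → ℕ
sumBelow zero    f = 0
sumBelow (suc k) f = sumBelow k f + f k

boxCount : Grid → ℕ → ℕ → ℕ → ℕ
boxCount G s X Y =
  sumBelow s (λ a → sumBelow s (λ b → if G (X * s + a) (Y * s + b) then 1 else 0))

Adj : ℕ → ℕ → ℕ → ℕ → Set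
Adj x y x' y' = (∣ x - x' ∣ ≤ 1) × (∣ y - y' ∣ ≤ 1)

data Reach (G : Grid) : ℕ → ℕ → ℕ → ℕ → Set where
  here : ∀ {x y} → T (G x y) → Reach G x y x y
  step : ∀ {x y x' y' x'' y''} → T (G x y) → Adj x y x' y' →
         Reach G x' y' x'' y'' → Reach G x y x'' y''

Connected : Grid → Set
Connected G = ∀ x y x' y' → T (G x y) → T (G x' y') → Reach G x y x' y'

isOdd : ℕ → Bool
isOdd zero = false
isOdd (suc zero) = true
isOdd (suc (suc k)) = isOdd k

-- Result of phase i (i ≥ 1) of U-Box-Doubling applied to configuration G:
-- inside every 2^i × 2^i sub-box holding c nodes, the nodes are rearranged
-- (within that sub-box) into
--   odd i : full leftmost columns + a bottom-aligned incomplete column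
--           (cell with local coords (a , b) occupied iff a * s + b < c);
--   even i: full bottommost rows + a left-aligned incomplete row
--           (cell with local coords (a , b) occupied iff b * s + a < c).
phase : ℕ → Grid → Grid
phase i G x y =
  let s = 2 ^ i
      instance _ = m^n≢0 2 i
      X = x / s
      Y = y / s
      a = x % s
      b = y % s
      c = boxCount G s X Y
  in if isOdd i then (a * s + b) <ᵇ c else (b * s + a) <ᵇ c

config : ℕ → Grid → Grid
config zero    S = S
config (suc i) S = phase (suc i) (config i S)

superShape : ℕ → Grid → Grid
superShape s G X Y = 0 <ᵇ boxCount G s X Y

InBox : ℕ → Grid → Set
InBox n S = ∀ x y → T (S x y) → (suc x ≤ n) × (suc y ≤ n)

module Submission where

-- The proof rests on one invariant: a phase j only moves nodes inside their
-- own 2^j-box and leaves a non-empty 2^j-box non-empty, so it does not change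
-- WHICH 2^j-boxes are occupied; since every 2^i-box with j ≤ i is a union of
-- 2^j-boxes, it does not change which 2^i-boxes are occupied either.  Hence
-- for j ≤ i the super-shape of config j S at scale 2^i is the super-shape of
-- the initial shape S.  The latter is the image of S under the map
-- (x , y) ↦ (x / 2^i , y / 2^i), which sends neighbouring cells to
-- neighbouring (or equal) boxes, so it is connected whenever S is.

open import Defs
open import Data.Nat using (ℕ; zero; suc; _+_; _*_; _^_; _≤_; _<_; _∸_; z≤n; s≤s; NonZero; ∣_-_∣; _<ᵇ_; _<?_)
open import Data.Nat.Properties
open import Data.Nat.DivMod
open import Data.Nat.Divisibility using (divides-refl)
open import Data.Bool using (true; false; if_then_else_; T)
open import Data.Unit using (tt)
open import Data.Sum using (inj₁; inj₂)
open import Data.Product using (_×_; _,_; Σ; ∃₂)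
open import Relation.Nullary using (yes; no)
open import Relation.Binary.PropositionalEquality

sumBelow-pos⇒ : ∀ k f → 0 < sumBelow k f → Σ ℕ λ m → m < k × 0 < f m
sumBelow-pos⇒ (suc k) f pos with 0 <? f k
... | yes fk-pos = k , n<1+n k , fk-pos
... | no fk-zero with sumBelow-pos⇒ k f (subst (0 <_) sum-without-last pos)
  where
  sum-without-last : sumBelow k f + f k ≡ sumBelow k f
  sum-without-last = trans (cong (sumBelow k f +_) (n≤0⇒n≡0 (≮⇒≥ fk-zero))) (+-identityʳ _)
... | m , m<k , fm-pos = m , m<n⇒m<1+n m<k , fm-pos

sumBelow-pos⇐ : ∀ k f m → m < k → 0 < f m → 0 < sumBelow k f
sumBelow-pos⇐ (suc k) f m m<1+k fm-pos with m<1+n⇒m<n∨m≡n m<1+k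
... | inj₁ m<k  = <-≤-trans (sumBelow-pos⇐ k f m m<k fm-pos) (m≤m+n _ _)
... | inj₂ refl = <-≤-trans fm-pos (m≤n+m _ _)

indicator-pos⇒ : ∀ b → 0 < (if b then 1 else 0) → T b
indicator-pos⇒ true _ = tt

indicator-pos⇐ : ∀ b → T b → 0 < (if b then 1 else 0)
indicator-pos⇐ true _ = s≤s z≤n

box-decomposition : ∀ x s .{{_ : NonZero s}} → x ≡ x / s * s + x % s
box-decomposition x s = trans (m≡m%n+[m/n]*n x s) (+-comm (x % s) _)

box-of-offset : ∀ X s a .{{_ : NonZero s}} → a < s → (X * s + a) / s ≡ X
box-of-offset X s a a<s = begin
  (X * s + a) / s   ≡⟨ +-distrib-/-∣ˡ {X * s} a {s} (divides-refl X) ⟩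
  X * s / s + a / s ≡⟨ cong₂ _+_ (m*n/n≡m X s) (m<n⇒m/n≡0 a<s) ⟩
  X + 0             ≡⟨ +-identityʳ X ⟩
  X                 ∎
  where open ≡-Reasoning

Occupied : Grid → (s : ℕ) → .{{NonZero s}} → ℕ → ℕ → Set
Occupied G s X Y = ∃₂ λ x y → T (G x y) × x / s ≡ X × y / s ≡ Y

count-pos⇒occupied : ∀ G s .{{_ : NonZero s}} X Y → 0 < boxCount G s X Y → Occupied G s X Y
count-pos⇒occupied G s X Y pos with sumBelow-pos⇒ s _ pos
... | a , a<s , column-pos with sumBelow-pos⇒ s _ column-pos
... | b , b<s , cell-pos =
  X * s + a , Y * s + b , indicator-pos⇒ _ cell-pos , box-of-offset X s a a<s , box-of-offset Y s b b<s

occupied⇒count-pos : ∀ G s .{{_ : NonZero s}} X Y → Occupied G s X Y → 0 < boxCount G s X Y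
occupied⇒count-pos G s _ _ (x , y , node , refl , refl) =
  sumBelow-pos⇐ s _ (x % s) (m%n<n x s) (sumBelow-pos⇐ s _ (y % s) (m%n<n y s) (indicator-pos⇐ _ node′))
  where
  node′ : T (G (x / s * s + x % s) (y / s * s + y % s))
  node′ = subst₂ (λ u v → T (G u v)) (box-decomposition x s) (box-decomposition y s) node

superShape⇒occupied : ∀ G s .{{_ : NonZero s}} X Y → T (superShape s G X Y) → Occupied G s X Y
superShape⇒occupied G s X Y p = count-pos⇒occupied G s X Y (<ᵇ⇒< 0 _ p)

occupied⇒superShape : ∀ G s .{{_ : NonZero s}} X Y → Occupied G s X Y → T (superShape s G X Y)
occupied⇒superShape G s X Y o = <⇒<ᵇ (occupied⇒count-pos G s X Y o)

dist≤1⇒ : ∀ x y → ∣ x - y ∣ ≤ 1 → x ≤ suc y × y ≤ suc x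
dist≤1⇒ zero    y       d = z≤n , d
dist≤1⇒ (suc x) zero    d = d , z≤n
dist≤1⇒ (suc x) (suc y) d with dist≤1⇒ x y d
... | x≤1+y , y≤1+x = s≤s x≤1+y , s≤s y≤1+x

dist≤1⇐ : ∀ x y → x ≤ suc y → y ≤ suc x → ∣ x - y ∣ ≤ 1
dist≤1⇐ zero    y       _         y≤1       = y≤1
dist≤1⇐ (suc x) zero    x≤0       _         = x≤0
dist≤1⇐ (suc x) (suc y) (s≤s x≤y) (s≤s y≤x) = dist≤1⇐ x y x≤y y≤x

/-step : ∀ x y s .{{_ : NonZero s}} → x ≤ suc y → x / s ≤ suc (y / s)
/-step x y s x≤1+y = begin
  x / s                   ≤⟨ /-monoˡ-≤ s x≤1+y ⟩
  suc y / s               ≤⟨ /-monoˡ-≤ s next-box ⟩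
  suc (y / s) * s / s     ≡⟨ m*n/n≡m (suc (y / s)) s ⟩
  suc (y / s)             ∎
  where
  open ≤-Reasoning
  next-box : suc y ≤ suc (y / s) * s
  next-box = begin
    suc y                    ≡⟨ cong suc (box-decomposition y s) ⟩
    suc (y / s * s + y % s)  ≡⟨ +-suc (y / s * s) (y % s) ⟨
    y / s * s + suc (y % s)  ≤⟨ +-monoʳ-≤ (y / s * s) (m%n<n y s) ⟩
    y / s * s + s            ≡⟨ +-comm (y / s * s) s ⟩
    suc (y / s) * s          ∎

/-preserves-dist≤1 : ∀ s .{{_ : NonZero s}} x x' → ∣ x - x' ∣ ≤ 1 → ∣ x / s - x' / s ∣ ≤ 1
/-preserves-dist≤1 s x x' d with dist≤1⇒ x x' d
... | x≤1+x' , x'≤1+x = dist≤1⇐ _ _ (/-step x x' s x≤1+x') (/-step x' x s x'≤1+x)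

Lipschitz : (ℕ → ℕ) → Set
Lipschitz f = ∀ x x' → ∣ x - x' ∣ ≤ 1 → ∣ f x - f x' ∣ ≤ 1

reach-map : ∀ {G H : Grid} (f g : ℕ → ℕ) → Lipschitz f → Lipschitz g →
  (∀ x y → T (G x y) → T (H (f x) (g y))) →
  ∀ {x y x' y'} → Reach G x y x' y' → Reach H (f x) (g y) (f x') (g y')
reach-map f g lip-f lip-g into (here node) = here (into _ _ node)
reach-map f g lip-f lip-g into (step node (dx , dy) path) =
  step (into _ _ node) (lip-f _ _ dx , lip-g _ _ dy) (reach-map f g lip-f lip-g into path)

connected-image : ∀ {G H : Grid} (f g : ℕ → ℕ) → Lipschitz f → Lipschitz g →
  (∀ x y → T (G x y) → T (H (f x) (g y))) →
  (∀ X Y → T (H X Y) → ∃₂ λ x y → T (G x y) × f x ≡ X × g y ≡ Y) →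
  Connected G → Connected H
connected-image {G} {H} f g lip-f lip-g into onto conn X Y X' Y' p q = path (onto X Y p) (onto X' Y' q)
  where
  path : (∃₂ λ x y → T (G x y) × f x ≡ X × g y ≡ Y) →
         (∃₂ λ x y → T (G x y) × f x ≡ X' × g y ≡ Y') → Reach H X Y X' Y'
  path (x , y , node , refl , refl) (x' , y' , node' , refl , refl) =
    reach-map f g lip-f lip-g into (conn x y x' y' node node')

Covers : (s : ℕ) → .{{NonZero s}} → Grid → Grid → Set
Covers s G H = ∀ X Y → Occupied G s X Y → Occupied H s X Y

SameOccupancy : (s : ℕ) → .{{NonZero s}} → Grid → Grid → Set
SameOccupancy s G H = Covers s G H × Covers s H G

sameOccupancy-trans : ∀ s .{{_ : NonZero s}} {G H K} →
  SameOccupancy s G H → SameOccupancy s H K → SameOccupancy s G K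
sameOccupancy-trans s (G⊆H , H⊆G) (H⊆K , K⊆H) =
  (λ X Y o → H⊆K X Y (G⊆H X Y o)) , (λ X Y o → H⊆G X Y (K⊆H X Y o))

same-box-coarsen : ∀ t u s .{{_ : NonZero t}} .{{_ : NonZero u}} .{{_ : NonZero s}} →
  t * u ≡ s → ∀ x x' → x / t ≡ x' / t → x / s ≡ x' / s
same-box-coarsen t u .(t * u) refl x x' same-box = begin
  x / (t * u)  ≡⟨ m/n/o≡m/[n*o] x t u ⟨
  x / t / u    ≡⟨ cong (_/ u) same-box ⟩
  x' / t / u   ≡⟨ m/n/o≡m/[n*o] x' t u ⟩
  x' / (t * u) ∎
  where open ≡-Reasoning

-- Each s-box is tiled by t-boxes, so covering at scale t implies covering at scale s.
covers-coarsen : ∀ t u s .{{_ : NonZero t}} .{{_ : NonZero u}} .{{_ : NonZero s}} {G H} →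
  t * u ≡ s → Covers t G H → Covers s G H
covers-coarsen t u s t*u≡s G⊆H _ _ (x , y , node , refl , refl)
  with G⊆H (x / t) (y / t) (x , y , node , refl , refl)
... | x' , y' , node' , same-x , same-y =
  x' , y' , node' , same-box-coarsen t u s t*u≡s x' x same-x , same-box-coarsen t u s t*u≡s y' y same-y

sameOccupancy-coarsen : ∀ t u s .{{_ : NonZero t}} .{{_ : NonZero u}} .{{_ : NonZero s}} {G H} →
  t * u ≡ s → SameOccupancy t G H → SameOccupancy s G H
sameOccupancy-coarsen t u s t*u≡s (G⊆H , H⊆G) =
  covers-coarsen t u s t*u≡s G⊆H , covers-coarsen t u s t*u≡s H⊆G

-- If G has the same occupied boxes as a connected S, its super-shape is the
-- image of S under division by s, hence connected.
superShape-connected : ∀ s .{{_ : NonZero s}} {G S} → SameOccupancy s G S →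
  Connected S → Connected (superShape s G)
superShape-connected s {G} {S} (G⊆S , S⊆G) =
  connected-image (_/ s) (_/ s) (/-preserves-dist≤1 s) (/-preserves-dist≤1 s) into onto
  where
  into : ∀ x y → T (S x y) → T (superShape s G (x / s) (y / s))
  into x y node = occupied⇒superShape G s _ _ (S⊆G _ _ (x , y , node , refl , refl))
  onto : ∀ X Y → T (superShape s G X Y) → Occupied S s X Y
  onto X Y p = G⊆S X Y (superShape⇒occupied G s X Y p)

phase-cell⇒count-pos : ∀ b n m c → T (if b then n <ᵇ c else m <ᵇ c) → 0 < c
phase-cell⇒count-pos true  n m c p = ≤-trans (s≤s z≤n) (<ᵇ⇒< n c p)
phase-cell⇒count-pos false n m c p = ≤-trans (s≤s z≤n) (<ᵇ⇒< m c p)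

-- Phase i fills the corner cell (local coordinates (0 , 0)) of every non-empty box.
corner-filled : ∀ b c → T (0 <ᵇ c) → T (if b then 0 <ᵇ c else 0 <ᵇ c)
corner-filled true  c p = p
corner-filled false c p = p

2^-nonZero : ∀ i → NonZero (2 ^ i)
2^-nonZero i = m^n≢0 2 i

-- Phase i rearranges nodes inside each 2^i-box and keeps non-empty boxes
-- non-empty, so it occupies exactly the 2^i-boxes G occupies.
phase-sameOccupancy : ∀ i G → SameOccupancy (2 ^ i) {{2^-nonZero i}} (phase i G) G
phase-sameOccupancy i G = phase⊆G , G⊆phase
  where
  s : ℕ
  s = 2 ^ i
  instance
    2^i-nonZero : NonZero (2 ^ i)
    2^i-nonZero = 2^-nonZero i
  phase⊆G : Covers s (phase i G) G
  phase⊆G _ _ (x , y , node , refl , refl) =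
    count-pos⇒occupied G s (x / s) (y / s) (phase-cell⇒count-pos (isOdd i) _ _ _ node)
  corner : ∀ X Y → 0 < boxCount G s X Y → T (phase i G (X * s) (Y * s))
  corner X Y pos
    rewrite m*n%n≡0 X s {{2^-nonZero i}} | m*n%n≡0 Y s {{2^-nonZero i}}
          | m*n/n≡m X s {{2^-nonZero i}} | m*n/n≡m Y s {{2^-nonZero i}} =
    corner-filled (isOdd i) (boxCount G s X Y) (<⇒<ᵇ pos)
  G⊆phase : Covers s G (phase i G)
  G⊆phase X Y o = X * s , Y * s , corner X Y (occupied⇒count-pos G s X Y o) , m*n/n≡m X s , m*n/n≡m Y s

2^-split : ∀ {j i} → j ≤ i → 2 ^ j * 2 ^ (i ∸ j) ≡ 2 ^ i
2^-split {j} {i} j≤i = trans (sym (^-distribˡ-+-* 2 j (i ∸ j))) (cong (2 ^_) (m+[n∸m]≡n j≤i))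

config-sameOccupancy : ∀ i j S → j ≤ i → SameOccupancy (2 ^ i) {{2^-nonZero i}} (config j S) S
config-sameOccupancy i zero    S _   = (λ _ _ o → o) , (λ _ _ o → o)
config-sameOccupancy i (suc j) S 1+j≤i =
  sameOccupancy-trans (2 ^ i) {{2^-nonZero i}}
    (sameOccupancy-coarsen (2 ^ suc j) (2 ^ (i ∸ suc j)) (2 ^ i)
       {{2^-nonZero (suc j)}} {{2^-nonZero (i ∸ suc j)}} {{2^-nonZero i}} (2^-split 1+j≤i)
       (phase-sameOccupancy (suc j) (config j S)))
    (config-sameOccupancy i j S (≤-trans (n≤1+n j) 1+j≤i))

lemma4p8 : (k : ℕ) (S : Grid) →
    InBox (2 ^ k) S →
    boxCount S (2 ^ k) 0 0 ≡ 2 ^ k →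
    Connected S →
    (i : ℕ) → i ≤ k →
    Connected (superShape (2 ^ i) (config i S))
    × (1 ≤ i → Connected (superShape (2 ^ i) (config (i ∸ 1) S)))
lemma4p8 k S _ _ conn i _ =
  superShape-connected (2 ^ i) (config-sameOccupancy i i S ≤-refl) conn ,
  λ _ → superShape-connected (2 ^ i) (config-sameOccupancy i (i ∸ 1) S (m∸n≤m i 1)) conn
  where
  instance
    2^i-nonZero : NonZero (2 ^ i)
    2^i-nonZero = 2^-nonZero i
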